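{- Let $\Gamma$ be a distance-regular graph with diameter $D\ge3$. For every $\theta\in\mathbb{C}\cup\{\infty\}$, the space $\mathbf{M}(\theta)$ has dimension $1$.
   Context: $\Gamma$ is a finite connected distance-regular graph with diameter $D$; $A_i$ is its $i$th distance matrix ($yz$-entry $1$ if the distance between $y,z$ is $i$, else $0$), $A=A_1$, and $\mathbf{M}$ is the Bose–Mesner algebra (the algebra generated by $A$, with basis $A_0,\dots,A_D$). For $\theta\in\mathbb{C}$, $\mathbf{M}(\theta)=\{Y\in\mathbf{M}:(A-\theta I)Y\in\mathbb{C}A_D\}$; and $\mathbf{M}(\infty)=\mathbb{C}A_D$. -}

module Defs where

open import Level using (Level; _⊔_) renaming (suc to lsuc)
open import Algebra.Bundles using (CommutativeRing)
open import Data.Nat using (ℕ; zero; suc)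
open import Data.Fin using (Fin; zero; suc; toℕ; _≟_)
open import Data.Bool using (Bool; true; false; _∧_; _∨_; not; if_then_else_)
open import Data.List using (List; []; _∷_)
open import Data.Maybe using (Maybe; just; nothing)
open import Data.Product using (Σ; ∃; _×_; _,_)
open import Relation.Nullary using (¬_)
open import Relation.Nullary.Decidable using (⌊_⌋)
open import Relation.Binary.PropositionalEquality using (_≡_)

record Field (c ℓ : Level) : Set (lsuc (c ⊔ ℓ)) where
  field
    commRing : CommutativeRing c ℓ
  open CommutativeRing commRing public
  field
    1≉0 : ¬ (1# ≈ 0#)
    inverse : ∀ x → ¬ (x ≈ 0#) → ∃ λ y → x * y ≈ 1#

module _ {c ℓ : Level} (F : Field c ℓ) where
  open Field F using (Carrier; _≈_; _+_; _*_; _-_; 0#; 1#)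

  natK : ℕ → Carrier
  natK zero = 0#
  natK (suc m) = 1# + natK m

  CharZero : Set ℓ
  CharZero = ∀ m → ¬ (natK (suc m) ≈ 0#)

  -- monicEval (a₀ ∷ … ∷ a_{d-1} ∷ []) x = a₀ + a₁ x + … + a_{d-1} x^{d-1} + x^d
  monicEval : List Carrier → Carrier → Carrier
  monicEval [] x = 1#
  monicEval (a ∷ as) x = a + x * monicEval as x

  AlgClosed : Set (c ⊔ ℓ)
  AlgClosed = ∀ a as → ∃ λ x → monicEval (a ∷ as) x ≈ 0#

record Graph (n : ℕ) : Set where
  field
    adj : Fin n → Fin n → Bool
    adj-sym : ∀ x y → adj x y ≡ adj y x
    adj-irrefl : ∀ x → adj x x ≡ false
open Graph public

anyFin : ∀ {m} → (Fin m → Bool) → Bool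
anyFin {zero} p = false
anyFin {suc m} p = p zero ∨ anyFin (λ i → p (suc i))

countFin : ∀ {m} → (Fin m → Bool) → ℕ
countFin {zero} p = 0
countFin {suc m} p = (if p zero then 1 else 0) Data.Nat.+ countFin (λ i → p (suc i))

module _ {n : ℕ} (G : Graph n) where

  within : ℕ → Fin n → Fin n → Bool
  within zero x y = ⌊ x ≟ y ⌋
  within (suc k) x y = within k x y ∨ anyFin (λ z → adj G x z ∧ within k z y)

  distIs : ℕ → Fin n → Fin n → Bool
  distIs zero x y = within zero x y
  distIs (suc i) x y = within (suc i) x y ∧ not (within i x y)

  HasDiameter : ℕ → Set
  HasDiameter D = (∀ x y → within D x y ≡ true)
                × (∃ λ x → ∃ λ y → distIs D x y ≡ true)

  DistanceRegular : Set
  DistanceRegular = ∀ h i j → ∃ λ p → ∀ x y → distIs h x y ≡ true →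
    countFin (λ z → distIs i x z ∧ distIs j y z) ≡ p

module _ {c ℓ : Level} (F : Field c ℓ) where
  open Field F using (Carrier; _≈_; _+_; _*_; _-_; 0#; 1#)

  sumFin : ∀ {m} → (Fin m → Carrier) → Carrier
  sumFin {zero} f = 0#
  sumFin {suc m} f = f zero + sumFin (λ i → f (suc i))

  module _ {n : ℕ} where
    Mat : Set c
    Mat = Fin n → Fin n → Carrier

    _≈ₘ_ : Mat → Mat → Set ℓ
    X ≈ₘ Y = ∀ x y → X x y ≈ Y x y

    _*ₘ_ : Mat → Mat → Mat
    (X *ₘ Y) x y = sumFin (λ z → X x z * Y z y)

    _-ₘ_ : Mat → Mat → Mat
    (X -ₘ Y) x y = X x y - Y x y

    _·ₘ_ : Carrier → Mat → Mat
    (a ·ₘ X) x y = a * X x y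

    zeroM : Mat
    zeroM x y = 0#

    idM : Mat
    idM x y = if ⌊ x ≟ y ⌋ then 1# else 0#

  module _ {n : ℕ} (G : Graph n) (D : ℕ) where

    distMat : ℕ → Mat {n}
    distMat i x y = if distIs G i x y then 1# else 0#

    adjMat : Mat {n}
    adjMat = distMat 1

    InBM : Mat {n} → Set (c ⊔ ℓ)
    InBM Y = ∃ λ (α : Fin (suc D) → Carrier) →
      Y ≈ₘ (λ x y → sumFin (λ i → α i * distMat (toℕ i) x y))

    -- 𝐌(θ) for θ ∈ ℂ ∪ {∞}; θ = nothing encodes ∞
    InMθ : Maybe Carrier → Mat {n} → Set (c ⊔ ℓ)
    InMθ (just θ) Y = InBM Y ×
      ∃ λ β → ((adjMat -ₘ (θ ·ₘ idM)) *ₘ Y) ≈ₘ (β ·ₘ distMat D)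
    InMθ nothing Y = ∃ λ β → Y ≈ₘ (β ·ₘ distMat D)

  DimOne : ∀ {n p} → (Mat {n} → Set p) → Set (c ⊔ ℓ ⊔ p)
  DimOne {n} S = ∃ λ Y₀ → S Y₀ × ¬ (Y₀ ≈ₘ zeroM) ×
    (∀ Y → S Y → ∃ λ a → Y ≈ₘ (a ·ₘ Y₀))

{-# OPTIONS --safe #-}
-- Write ∂ for the path-length distance.  Every Y ∈ 𝐌 is radial, Y x y = h (∂ x y), and counting
-- the neighbours z of x by their distance to y gives (A Y) x y = Σ_k p^j_{1k} h k when ∂ x y = j,
-- where p^j_{1k} = 0 for k > j + 1.  As every distance j ≤ D is realised, (A − θI) Y ∈ ℂ A_D says
-- exactly that Σ_{k ≤ j+1} p^j_{1k} h k = θ h j for all j < D.  The top coefficient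
-- b_j = p^j_{1,j+1} is a positive integer, invertible in characteristic zero, so this recurrence
-- determines h on 0 … D from h 0, and the radial matrix of its solution with h 0 = 1 spans 𝐌(θ).
-- 𝐌(∞) = ℂ A_D is one-dimensional because A_D ≠ 0.
module Submission where

open import Defs
open import Level using (Level)
open import Algebra.Bundles using (CommutativeRing)
open import Data.Bool as Bool using (Bool; true; false; _∧_; _∨_; not; if_then_else_)
open import Data.Empty using (⊥-elim)
open import Data.Fin using (Fin; zero; suc; toℕ; fromℕ<; _≟_; punchIn)
open import Data.Fin.Properties
  using (punchInᵢ≢i; toℕ-inject₁; toℕ-fromℕ; toℕ<n; toℕ-fromℕ<; fromℕ<-toℕ; toℕ-injective)
open import Data.Maybe using (Maybe; just; nothing)
open import Data.Nat
  using (ℕ; zero; suc; _≤_; _<_; _≤′_; ≤′-refl; ≤′-step; z≤n; s≤s; _≤?_; _<?_)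
open import Data.Nat.Properties
  using (≤⇒≤′; ≤′⇒≤; ≰⇒>; ≤-antisym; ≤-refl; ≤-trans; ≤-pred; n≤1+n; <⇒≤; >⇒≢; 1+n≰n
        ; m<1+n⇒m≤n; m<n⇒m<1+n; m≤n⇒m<n∨m≡n)
open import Data.Nat.Induction using (<-rec)
open import Data.Product using (∃; ∃₂; _×_; _,_; proj₁; proj₂)
open import Data.Sum using (_⊎_; inj₁; inj₂)
open import Function using (_∘_; case_of_; _⇔_; mk⇔; Equivalence)
open import Relation.Binary.PropositionalEquality as ≡ using (_≡_; _≢_; refl)
open import Relation.Nullary using (¬_; yes; no)
open import Relation.Nullary.Decidable using (dec-true; dec-false; isYes≗does)

∨-introˡ : ∀ {a} b → a ≡ true → a ∨ b ≡ true
∨-introˡ b refl = refl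

∨-introʳ : ∀ a {b} → b ≡ true → a ∨ b ≡ true
∨-introʳ true  _ = refl
∨-introʳ false p = p

∨-elim : ∀ a {b} → a ∨ b ≡ true → a ≡ true ⊎ b ≡ true
∨-elim true  _ = inj₁ refl
∨-elim false p = inj₂ p

∧-intro : ∀ {a b} → a ≡ true → b ≡ true → a ∧ b ≡ true
∧-intro refl p = p

∧-elimˡ : ∀ a {b} → a ∧ b ≡ true → a ≡ true
∧-elimˡ true _ = refl

∧-elimʳ : ∀ a {b} → a ∧ b ≡ true → b ≡ true
∧-elimʳ true p = p

not-true⇒¬true : ∀ a → not a ≡ true → ¬ a ≡ true
not-true⇒¬true false _ ()

¬true⇒not-true : ∀ a → ¬ a ≡ true → not a ≡ true
¬true⇒not-true false _ = refl
¬true⇒not-true true  p = ⊥-elim (p refl)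

true⇔true⇒≡ : ∀ {a b} → (a ≡ true → b ≡ true) → (b ≡ true → a ≡ true) → a ≡ b
true⇔true⇒≡ {true}  {true}  _ _ = refl
true⇔true⇒≡ {true}  {false} f _ = ≡.sym (f refl)
true⇔true⇒≡ {false} {true}  _ g = g refl
true⇔true⇒≡ {false} {false} _ _ = refl

anyFin-intro : ∀ {m} (p : Fin m → Bool) i → p i ≡ true → anyFin p ≡ true
anyFin-intro p zero    pi = ∨-introˡ _ pi
anyFin-intro p (suc i) pi = ∨-introʳ (p zero) (anyFin-intro (λ j → p (suc j)) i pi)

anyFin-elim : ∀ {m} (p : Fin m → Bool) → anyFin p ≡ true → ∃ λ i → p i ≡ true
anyFin-elim {suc m} p any with ∨-elim (p zero) any
... | inj₁ p0 = zero , p0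
... | inj₂ rest with anyFin-elim (λ j → p (suc j)) rest
...   | i , pi = suc i , pi

countFin-≢0 : ∀ {m} (p : Fin m → Bool) i → p i ≡ true → countFin p ≢ 0
countFin-≢0 p zero    pi rewrite pi = λ ()
countFin-≢0 p (suc i) pi with p zero
... | true  = λ ()
... | false = countFin-≢0 (λ j → p (suc j)) i pi

countFin-≡0 : ∀ {m} (p : Fin m → Bool) → (∀ i → ¬ p i ≡ true) → countFin p ≡ 0
countFin-≡0 {zero}  p none = refl
countFin-≡0 {suc m} p none with p zero in p0
... | true  = ⊥-elim (none zero p0)
... | false = countFin-≡0 (λ j → p (suc j)) (λ j → none (suc j))

extendToℕ : ∀ {a} {A : Set a} {m} → (Fin m → A) → A → ℕ → A
extendToℕ {m = m} f d k with k <? m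
... | yes k<m = f (fromℕ< k<m)
... | no  _   = d

extendToℕ-toℕ : ∀ {a} {A : Set a} {m} (f : Fin m → A) d i → extendToℕ f d (toℕ i) ≡ f i
extendToℕ-toℕ {m = m} f d i with toℕ i <? m
... | yes i<m = ≡.cong f (fromℕ<-toℕ i i<m)
... | no  i≮m = ⊥-elim (i≮m (toℕ<n i))

module WalkDistance {n : ℕ} (G : Graph n) where

  Adj : Fin n → Fin n → Set
  Adj x y = adj G x y ≡ true

  Within : ℕ → Fin n → Fin n → Set
  Within k x y = within G k x y ≡ true

  Dist : ℕ → Fin n → Fin n → Set
  Dist i x y = distIs G i x y ≡ true

  within-refl : ∀ x → Within 0 x x
  within-refl x = ≡.trans (isYes≗does (x ≟ x)) (dec-true (x ≟ x) refl)

  within-zero⁻ : ∀ {x y} → Within 0 x y → x ≡ y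
  within-zero⁻ {x} {y} w with x ≟ y
  ... | yes x≡y = x≡y

  within-suc : ∀ k {x y} → Within k x y → Within (suc k) x y
  within-suc k = ∨-introˡ _

  within-mono : ∀ {k m} → k ≤ m → ∀ {x y} → Within k x y → Within m x y
  within-mono k≤m = go (≤⇒≤′ k≤m)
    where
    go : ∀ {k m} → k ≤′ m → ∀ {x y} → Within k x y → Within m x y
    go ≤′-refl          w = w
    go (≤′-step {m} k≤m) w = within-suc m (go k≤m w)

  within-cons : ∀ k {x z y} → Adj x z → Within k z y → Within (suc k) x y
  within-cons k {x} {z} {y} x~z w =
    ∨-introʳ (within G k x y)
             (anyFin-intro (λ z′ → adj G x z′ ∧ within G k z′ y) z (∧-intro x~z w))

  within-suc⁻ : ∀ k {x y} → Within (suc k) x y →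
                Within k x y ⊎ ∃ λ z → Adj x z × Within k z y
  within-suc⁻ k {x} {y} w with ∨-elim (within G k x y) w
  ... | inj₁ w′ = inj₁ w′
  ... | inj₂ any with anyFin-elim (λ z → adj G x z ∧ within G k z y) any
  ...   | z , step = inj₂ (z , ∧-elimˡ (adj G x z) step , ∧-elimʳ (adj G x z) step)

  within-snoc : ∀ k {x w y} → Within k x w → Adj w y → Within (suc k) x y
  within-snoc zero w₀ w~y with within-zero⁻ w₀
  ... | refl = within-cons 0 w~y (within-refl _)
  within-snoc (suc k) w w~y with within-suc⁻ k w
  ... | inj₁ w′           = within-suc (suc k) (within-snoc k w′ w~y)
  ... | inj₂ (z , x~z , w′) = within-cons (suc k) x~z (within-snoc k w′ w~y)

  within-sym : ∀ k {x y} → Within k x y → Within k y x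
  within-sym zero w with within-zero⁻ w
  ... | refl = w
  within-sym (suc k) w with within-suc⁻ k w
  ... | inj₁ w′           = within-suc k (within-sym k w′)
  ... | inj₂ (z , x~z , w′) = within-snoc k (within-sym k w′) (≡.trans (adj-sym G _ _) x~z)

  dist⇒within : ∀ i {x y} → Dist i x y → Within i x y
  dist⇒within zero    d = d
  dist⇒within (suc i) {x} {y} d = ∧-elimˡ (within G (suc i) x y) d

  dist-suc⇒¬within : ∀ i {x y} → Dist (suc i) x y → ¬ Within i x y
  dist-suc⇒¬within i {x} {y} d = not-true⇒¬true _ (∧-elimʳ (within G (suc i) x y) d)

  dist-suc-intro : ∀ i {x y} → Within (suc i) x y → ¬ Within i x y → Dist (suc i) x y
  dist-suc-intro i w ¬w = ∧-intro w (¬true⇒not-true _ ¬w)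

  dist-sym : ∀ i {x y} → Dist i x y → Dist i y x
  dist-sym zero    d = within-sym 0 d
  dist-sym (suc i) d = dist-suc-intro i (within-sym (suc i) (dist⇒within (suc i) d))
                                        (λ w → dist-suc⇒¬within i d (within-sym i w))

  distIs-sym : ∀ i x y → distIs G i x y ≡ distIs G i y x
  distIs-sym i x y = true⇔true⇒≡ (dist-sym i) (dist-sym i)

  dist-≤ : ∀ {k m x y} → Dist k x y → Within m x y → k ≤ m
  dist-≤ {zero}      _ _ = z≤n
  dist-≤ {suc k} {m} d w with suc k ≤? m
  ... | yes k<m = k<m
  ... | no  k≮m = ⊥-elim (dist-suc⇒¬within k d (within-mono (m<1+n⇒m≤n (≰⇒> k≮m)) w))

  within⇒dist : ∀ k {x y} → Within k x y → ∃ λ i → i ≤ k × Dist i x y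
  within⇒dist zero    w = 0 , z≤n , w
  within⇒dist (suc k) {x} {y} w with within G k x y Bool.≟ true
  ... | yes wk = let i , i≤k , d = within⇒dist k wk in i , ≤-trans i≤k (n≤1+n k) , d
  ... | no ¬wk = suc k , ≤-refl , dist-suc-intro k w ¬wk

  dist-unique : ∀ {i j x y} → Dist i x y → Dist j x y → i ≡ j
  dist-unique {i} {j} di dj = ≤-antisym (dist-≤ di (dist⇒within j dj)) (dist-≤ dj (dist⇒within i di))

  adj⇒dist-one : ∀ {x y} → Adj x y → Dist 1 x y
  adj⇒dist-one {x} {y} x~y = dist-suc-intro 0 (within-cons 0 x~y (within-refl y)) x≢y
    where
    x≢y : ¬ Within 0 x y
    x≢y w with within-zero⁻ w
    ... | refl = case ≡.trans (≡.sym (adj-irrefl G x)) x~y of λ ()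

  dist-one⇒adj : ∀ {x y} → Dist 1 x y → Adj x y
  dist-one⇒adj d with within-suc⁻ 0 (dist⇒within 1 d)
  ... | inj₁ w₀ = ⊥-elim (dist-suc⇒¬within 0 d w₀)
  ... | inj₂ (z , x~z , w₀) with within-zero⁻ w₀
  ...   | refl = x~z

  dist-suc⁻ : ∀ j {x y} → Dist (suc j) x y → ∃ λ z → Adj x z × Dist j z y
  dist-suc⁻ j {x} {y} d with within-suc⁻ j (dist⇒within (suc j) d)
  ... | inj₁ w = ⊥-elim (dist-suc⇒¬within j d w)
  ... | inj₂ (z , x~z , w) with within⇒dist j w
  ...   | i , i≤j , dz = z , x~z , ≡.subst (λ i → Dist i z y) (≤-antisym i≤j j≤i) dz
    where
    j≤i : j ≤ i
    j≤i = ≤-pred (dist-≤ d (within-cons i x~z (dist⇒within i dz)))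

  realised-≤ : ∀ {i j x y} → j ≤ i → Dist i x y → ∃₂ (Dist j)
  realised-≤ j≤i = go (≤⇒≤′ j≤i)
    where
    go : ∀ {i j x y} → j ≤′ i → Dist i x y → ∃₂ (Dist j)
    go ≤′-refl          d = _ , _ , d
    go (≤′-step {i} j≤i) d = let z , _ , dz = dist-suc⁻ i d in go j≤i dz

module Diameter {n : ℕ} (G : Graph n) (D : ℕ) (hD : HasDiameter G D) where
  open WalkDistance G

  dist : Fin n → Fin n → ℕ
  dist x y = proj₁ (within⇒dist D (proj₁ hD x y))

  dist≤D : ∀ x y → dist x y ≤ D
  dist≤D x y = proj₁ (proj₂ (within⇒dist D (proj₁ hD x y)))

  Dist-dist : ∀ x y → Dist (dist x y) x y
  Dist-dist x y = proj₂ (proj₂ (within⇒dist D (proj₁ hD x y)))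

  Dist⇒≡dist : ∀ {i x y} → Dist i x y → i ≡ dist x y
  Dist⇒≡dist d = dist-unique d (Dist-dist _ _)

  realised : ∀ j → j ≤ D → ∃₂ (Dist j)
  realised j j≤D = let _ , _ , d = proj₂ hD in realised-≤ j≤D d

module DistanceRegularity {n : ℕ} (G : Graph n) (dr : DistanceRegular G) where
  open WalkDistance G

  p : ℕ → ℕ → ℕ → ℕ
  p h i j = proj₁ (dr h i j)

  p-count : ∀ {h} i j {x y} → Dist h x y →
            countFin (λ z → distIs G i x z ∧ distIs G j y z) ≡ p h i j
  p-count {h} i j = proj₂ (dr h i j) _ _

  p₁-vanish : ∀ {j} k {x y} → Dist j x y → suc j < k → p j 1 k ≡ 0
  p₁-vanish {j} (suc k) {x} {y} d (s≤s j<k) =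
    ≡.trans (≡.sym (p-count 1 (suc k) d)) (countFin-≡0 _ far)
    where
    far : ∀ z → ¬ (distIs G 1 x z ∧ distIs G (suc k) y z ≡ true)
    far z both = dist-suc⇒¬within k (∧-elimʳ (distIs G 1 x z) both)
      (within-mono j<k (within-snoc j (within-sym j (dist⇒within j d))
                                      (dist-one⇒adj (∧-elimˡ (distIs G 1 x z) both))))

  b≢0 : ∀ {j u v} → Dist (suc j) u v → p j 1 (suc j) ≢ 0
  b≢0 {j} {u} {v} d with dist-suc⁻ j d
  ... | w , u~w , dw = ≡.subst (_≢ 0) (p-count 1 (suc j) dw)
    (countFin-≢0 _ u (∧-intro (adj⇒dist-one (≡.trans (adj-sym G w u) u~w)) (dist-sym (suc j) d)))

module RingSums {c ℓ : Level} (R : CommutativeRing c ℓ) where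
  open CommutativeRing R renaming (refl to ≈-refl)
  open import Algebra.Properties.Semiring.Sum semiring public
    using (sum; sum-syntax; sum-cong-≋; ∑-comm; ∑-distrib-+; *-distribˡ-sum)
  open import Algebra.Properties.Semiring.Sum semiring
    using (sum-remove; sum-init-last; sum-replicate-zero; sum-cong-≗)
  open import Algebra.Properties.AbelianGroup +-abelianGroup using (xyx⁻¹≈y)
  open import Relation.Binary.Reasoning.Setoid setoid

  sum-single : ∀ {m} (t : Fin m → Carrier) i → (∀ j → j ≢ i → t j ≈ 0#) → sum t ≈ t i
  sum-single {suc m} t i off = begin
    sum t                             ≈⟨ sum-remove t ⟩
    t i + sum (λ j → t (punchIn i j)) ≈⟨ +-congˡ (sum-cong-≋ (λ j → off _ (punchInᵢ≢i i j))) ⟩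
    t i + sum {m} (λ _ → 0#)          ≈⟨ +-congˡ (sum-replicate-zero m) ⟩
    t i + 0#                          ≈⟨ +-identityʳ (t i) ⟩
    t i                               ∎

  sumTo : ℕ → (ℕ → Carrier) → Carrier
  sumTo m f = sum {m} (λ k → f (toℕ k))

  sumTo-suc : ∀ m f → sumTo (suc m) f ≈ sumTo m f + f m
  sumTo-suc m f = trans (sum-init-last (λ k → f (toℕ k)))
    (+-cong (reflexive (sum-cong-≗ {m} (λ k → ≡.cong f (toℕ-inject₁ k))))
            (reflexive (≡.cong f (toℕ-fromℕ m))))

  sumTo-cong : ∀ m f g → (∀ k → k < m → f k ≈ g k) → sumTo m f ≈ sumTo m g
  sumTo-cong m f g f≈g = sum-cong-≋ (λ k → f≈g (toℕ k) (toℕ<n k))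

  *-distribˡ-sumTo : ∀ m x f → x * sumTo m f ≈ sumTo m (λ k → x * f k)
  *-distribˡ-sumTo m x f = *-distribˡ-sum {m} x (λ k → f (toℕ k))

  sumTo-vanish : ∀ {m M} f → m ≤ M → (∀ k → m ≤ k → k < M → f k ≈ 0#) →
                 sumTo M f ≈ sumTo m f
  sumTo-vanish f m≤M = go (≤⇒≤′ m≤M)
    where
    go : ∀ {m M} → m ≤′ M → (∀ k → m ≤ k → k < M → f k ≈ 0#) → sumTo M f ≈ sumTo m f
    go ≤′-refl           _    = ≈-refl
    go {m} (≤′-step {M} m≤M) vanish = begin
      sumTo (suc M) f    ≈⟨ sumTo-suc M f ⟩
      sumTo M f + f M    ≈⟨ +-cong (go m≤M (λ k m≤k k<M → vanish k m≤k (m<n⇒m<1+n k<M)))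
                                   (vanish M (≤′⇒≤ m≤M) ≤-refl) ⟩
      sumTo m f + 0#     ≈⟨ +-identityʳ _ ⟩
      sumTo m f          ∎

  linear-equation : ∀ {N i} → N * i ≈ 1# → ∀ s x t → (s + x * N ≈ t ⇔ x ≈ (t - s) * i)
  linear-equation {N} {i} N*i≈1 s x t = mk⇔ solve check
    where
    cancel : ∀ y → y * N * i ≈ y
    cancel y = trans (*-assoc y N i) (trans (*-congˡ N*i≈1) (*-identityʳ y))
    cancel′ : ∀ y → y * i * N ≈ y
    cancel′ y = trans (*-assoc y i N) (trans (*-congˡ (trans (*-comm i N) N*i≈1)) (*-identityʳ y))
    solve : s + x * N ≈ t → x ≈ (t - s) * i
    solve eq = begin
      x                   ≈⟨ cancel x ⟨
      x * N * i           ≈⟨ *-congʳ (xyx⁻¹≈y s (x * N)) ⟨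
      (s + x * N - s) * i ≈⟨ *-congʳ (+-congʳ eq) ⟩
      (t - s) * i         ∎
    check : x ≈ (t - s) * i → s + x * N ≈ t
    check eq = begin
      s + x * N           ≈⟨ +-congˡ (*-congʳ eq) ⟩
      s + (t - s) * i * N ≈⟨ +-congˡ (cancel′ (t - s)) ⟩
      s + (t - s)         ≈⟨ +-assoc s t (- s) ⟨
      s + t - s           ≈⟨ xyx⁻¹≈y s t ⟩
      t                   ∎

module LinearRecurrence {c ℓ : Level} (R : CommutativeRing c ℓ) where
  open CommutativeRing R renaming (refl to ≈-refl)
  open RingSums R
  open import Algebra.Properties.Ring ring using (x[y-z]≈xy-xz)
  open import Algebra.Properties.CommutativeSemigroup *-commutativeSemigroup using (x∙yz≈y∙xz)
  open import Relation.Binary.Reasoning.Setoid setoid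

  module Hessenberg (a : ℕ → ℕ → Carrier) (θ : Carrier) (D : ℕ)
                    (inv : ℕ → Carrier) (a-inv : ∀ j → j < D → a j (suc j) * inv j ≈ 1#) where

    Solves : (ℕ → Carrier) → ℕ → Set ℓ
    Solves g j = sumTo (suc (suc j)) (λ k → g k * a j k) ≈ θ * g j

    next : (ℕ → Carrier) → ℕ → Carrier
    next g j = (θ * g j - sumTo (suc j) (λ k → g k * a j k)) * inv j

    solves⇔next : ∀ {j} g → j < D → Solves g j ⇔ g (suc j) ≈ next g j
    solves⇔next {j} g j<D = mk⇔
      (λ eq → to (trans (sym (sumTo-suc (suc j) terms)) eq))
      (λ eq → trans (sumTo-suc (suc j) terms) (from eq))
      where
      terms : ℕ → Carrier
      terms k = g k * a j k
      open Equivalence (linear-equation (a-inv j j<D) (sumTo (suc j) terms) (g (suc j)) (θ * g j))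

    next-cong : ∀ {f g} j → (∀ k → k ≤ j → f k ≈ g k) → next f j ≈ next g j
    next-cong {f} {g} j f≈g = *-congʳ (+-cong (*-congˡ (f≈g j ≤-refl))
      (-‿cong (sumTo-cong (suc j) (λ k → f k * a j k) (λ k → g k * a j k)
                          (λ k k<1+j → *-congʳ (f≈g k (m<1+n⇒m≤n k<1+j))))))

    next-scale : ∀ x g j → next (λ k → x * g k) j ≈ x * next g j
    next-scale x g j = begin
      (θ * (x * g j) - sumTo (suc j) (λ k → x * g k * a j k)) * inv j
        ≈⟨ *-congʳ (+-cong (x∙yz≈y∙xz θ x (g j)) (-‿cong pull-x)) ⟩
      (x * (θ * g j) - x * S) * inv j   ≈⟨ *-congʳ (x[y-z]≈xy-xz x (θ * g j) S) ⟨
      x * (θ * g j - S) * inv j         ≈⟨ *-assoc x (θ * g j - S) (inv j) ⟩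
      x * next g j                      ∎
      where
      S : Carrier
      S = sumTo (suc j) (λ k → g k * a j k)
      pull-x : sumTo (suc j) (λ k → x * g k * a j k) ≈ x * S
      pull-x = trans (sumTo-cong (suc j) (λ k → x * g k * a j k) (λ k → x * (g k * a j k))
                                 (λ k _ → *-assoc x (g k) (a j k)))
                     (sym (*-distribˡ-sumTo (suc j) x (λ k → g k * a j k)))

    -- Course-of-values recursion: approx j tabulates solution on 0 … j.
    approx : ℕ → ℕ → Carrier
    approx zero    k = 1#
    approx (suc j) k with k ≤? j
    ... | yes _ = approx j k
    ... | no  _ = next (approx j) j

    solution : ℕ → Carrier
    solution k = approx k k

    approx-new : ∀ j → approx (suc j) (suc j) ≡ next (approx j) j
    approx-new j with suc j ≤? j
    ... | yes 1+j≤j = ⊥-elim (1+n≰n 1+j≤j)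
    ... | no  _     = refl

    approx-stable : ∀ {j k} → k ≤ j → approx j k ≡ solution k
    approx-stable {zero}  z≤n = refl
    approx-stable {suc j} {k} k≤1+j with k ≤? j
    ... | yes k≤j = approx-stable k≤j
    ... | no  k≰j with ≤-antisym k≤1+j (≰⇒> k≰j)
    ...   | refl = ≡.sym (approx-new j)

    solution-suc : ∀ j → solution (suc j) ≈ next solution j
    solution-suc j = trans (reflexive (approx-new j))
                           (next-cong j (λ k k≤j → reflexive (approx-stable k≤j)))

    solution-solves : ∀ j → j < D → Solves solution j
    solution-solves j j<D = Equivalence.from (solves⇔next solution j<D) (solution-suc j)

    solution-unique : ∀ g → (∀ j → j < D → Solves g j) → ∀ k → k ≤ D → g k ≈ g 0 * solution k
    solution-unique g solves = <-rec _ step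
      where
      step : ∀ k → (∀ {i} → i < k → i ≤ D → g i ≈ g 0 * solution i) →
             k ≤ D → g k ≈ g 0 * solution k
      step zero    _  _     = sym (*-identityʳ (g 0))
      step (suc j) ih 1+j≤D = begin
        g (suc j)                       ≈⟨ Equivalence.to (solves⇔next g 1+j≤D) (solves j 1+j≤D) ⟩
        next g j                        ≈⟨ next-cong j (λ k k≤j → ih (s≤s k≤j) (≤-trans k≤j (<⇒≤ 1+j≤D))) ⟩
        next (λ k → g 0 * solution k) j ≈⟨ next-scale (g 0) solution j ⟩
        g 0 * next solution j           ≈⟨ *-congˡ (solution-suc j) ⟨
        g 0 * solution (suc j)          ∎

module Matrices {c ℓ : Level} (F : Field c ℓ) {n : ℕ} where
  open Field F hiding (zero) renaming (refl to ≈-refl)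
  open RingSums commRing
  open import Algebra.Properties.Ring ring using (-‿distribˡ-*; [y-z]x≈yx-zx)
  open import Relation.Binary.Reasoning.Setoid setoid

  𝟙 : Bool → Carrier
  𝟙 b = if b then 1# else 0#

  𝟙-true : ∀ {b} → b ≡ true → 𝟙 b ≈ 1#
  𝟙-true refl = ≈-refl

  𝟙-false : ∀ {b} → ¬ b ≡ true → 𝟙 b ≈ 0#
  𝟙-false {false} _  = ≈-refl
  𝟙-false {true}  ¬t = ⊥-elim (¬t refl)

  𝟙-∧ : ∀ a b → 𝟙 (a ∧ b) ≈ 𝟙 a * 𝟙 b
  𝟙-∧ true  b = sym (*-identityˡ (𝟙 b))
  𝟙-∧ false b = sym (zeroˡ (𝟙 b))

  sum-𝟙 : ∀ {m} (p : Fin m → Bool) → sum (λ i → 𝟙 (p i)) ≈ natK F (countFin p)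
  sum-𝟙 {zero}  p = ≈-refl
  sum-𝟙 {suc m} p with p zero
  ... | true  = +-congˡ (sum-𝟙 (λ i → p (suc i)))
  ... | false = trans (+-identityˡ _) (sum-𝟙 (λ i → p (suc i)))

  sumFin≡sum : ∀ {m} (f : Fin m → Carrier) → sumFin F f ≡ sum f
  sumFin≡sum {zero}  f = refl
  sumFin≡sum {suc m} f = ≡.cong (f zero +_) (sumFin≡sum (λ i → f (suc i)))

  idM-diagonal : ∀ x → idM F {n} x x ≈ 1#
  idM-diagonal x = 𝟙-true (≡.trans (isYes≗does (x ≟ x)) (dec-true (x ≟ x) refl))

  idM-off-diagonal : ∀ {x z} → x ≢ z → idM F {n} x z ≈ 0#
  idM-off-diagonal {x} {z} x≢z = reflexive (≡.cong 𝟙 (≡.trans (isYes≗does (x ≟ z)) (dec-false (x ≟ z) x≢z)))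

  *ₘ-identityˡ : ∀ (Y : Mat F {n}) x y → _*ₘ_ F (idM F) Y x y ≈ Y x y
  *ₘ-identityˡ Y x y = begin
    sumFin F (λ z → idM F x z * Y z y) ≡⟨ sumFin≡sum (λ z → idM F x z * Y z y) ⟩
    ∑[ z < n ] (idM F x z * Y z y)     ≈⟨ sum-single _ x off ⟩
    idM F x x * Y x y                  ≈⟨ *-congʳ (idM-diagonal x) ⟩
    1# * Y x y                         ≈⟨ *-identityˡ (Y x y) ⟩
    Y x y                              ∎
    where
    off : ∀ z → z ≢ x → idM F x z * Y z y ≈ 0#
    off z z≢x = trans (*-congʳ (idM-off-diagonal (z≢x ∘ ≡.sym))) (zeroˡ (Y z y))

  [X-θZ]Y≈XY-θ[ZY] : ∀ θ (X Z Y : Mat F {n}) x y →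
    _*ₘ_ F (_-ₘ_ F X (_·ₘ_ F θ Z)) Y x y ≈ _*ₘ_ F X Y x y - θ * _*ₘ_ F Z Y x y
  [X-θZ]Y≈XY-θ[ZY] θ X Z Y x y = begin
    sumFin F (λ w → (X x w - θ * Z x w) * Y w y)
      ≡⟨ sumFin≡sum (λ w → (X x w - θ * Z x w) * Y w y) ⟩
    ∑[ w < n ] ((X x w - θ * Z x w) * Y w y)
      ≈⟨ sum-cong-≋ (λ w → expand (X x w) (Z x w) (Y w y)) ⟩
    ∑[ w < n ] (X x w * Y w y + - θ * (Z x w * Y w y))
      ≈⟨ ∑-distrib-+ (λ w → X x w * Y w y) (λ w → - θ * (Z x w * Y w y)) ⟩
    ∑[ w < n ] (X x w * Y w y) + ∑[ w < n ] (- θ * (Z x w * Y w y))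
      ≈⟨ +-congˡ (*-distribˡ-sum (- θ) (λ w → Z x w * Y w y)) ⟨
    ∑[ w < n ] (X x w * Y w y) + - θ * ∑[ w < n ] (Z x w * Y w y)
      ≈⟨ +-congˡ (-‿distribˡ-* θ _) ⟨
    ∑[ w < n ] (X x w * Y w y) - θ * ∑[ w < n ] (Z x w * Y w y)
      ≡⟨ ≡.cong₂ (λ s t → s - θ * t) (≡.sym (sumFin≡sum (λ w → X x w * Y w y)))
                                     (≡.sym (sumFin≡sum (λ w → Z x w * Y w y))) ⟩
    sumFin F (λ w → X x w * Y w y) - θ * sumFin F (λ w → Z x w * Y w y) ∎
    where
    expand : ∀ a b y → (a - θ * b) * y ≈ a * y + - θ * (b * y)
    expand a b y = trans ([y-z]x≈yx-zx y a (θ * b))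
                         (+-congˡ (trans (-‿cong (*-assoc θ b y)) (-‿distribˡ-* θ (b * y))))

module CharZeroInverse {c ℓ : Level} (F : Field c ℓ) (char : CharZero F) where
  open Field F

  -- natK⁻¹ 0 is a junk value.
  natK⁻¹ : ℕ → Carrier
  natK⁻¹ zero    = 0#
  natK⁻¹ (suc m) = proj₁ (inverse (natK F (suc m)) (char m))

  natK⁻¹-inverse : ∀ {m} → m ≢ 0 → natK F m * natK⁻¹ m ≈ 1#
  natK⁻¹-inverse {zero}  0≢0 = ⊥-elim (0≢0 ≡.refl)
  natK⁻¹-inverse {suc m} _   = proj₂ (inverse (natK F (suc m)) (char m))

module BoseMesner {c ℓ : Level} (F : Field c ℓ) (char : CharZero F)
  {n : ℕ} (G : Graph n) (D : ℕ) (hD : HasDiameter G D) (dr : DistanceRegular G)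
  (θ : Field.Carrier F) where
  open Field F hiding (zero) renaming (refl to ≈-refl)
  open RingSums commRing
  open Matrices F {n}
  open CharZeroInverse F char
  open WalkDistance G
  open Diameter G D hD
  open DistanceRegularity G dr
  open import Algebra.Properties.AbelianGroup +-abelianGroup using (x∙y⁻¹≈ε⇒x≈y)
  open import Algebra.Properties.CommutativeSemigroup *-commutativeSemigroup using (x∙yz≈y∙xz)
  open import Relation.Binary.Reasoning.Setoid setoid

  A : ℕ → Mat F
  A = distMat F G D

  A-off : ∀ {i j x y} → Dist j x y → i ≢ j → A i x y ≈ 0#
  A-off dj i≢j = 𝟙-false (λ di → i≢j (dist-unique di dj))

  radial : (ℕ → Carrier) → Mat F
  radial h x y = h (dist x y)

  A-expansion : ∀ h x y → sumTo (suc D) (λ k → h k * A k x y) ≈ radial h x y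
  A-expansion h x y = begin
    sumTo (suc D) (λ k → h k * A k x y)     ≈⟨ sum-single _ i₀ off ⟩
    h (toℕ i₀) * A (toℕ i₀) x y             ≡⟨ ≡.cong (λ k → h k * A k x y) (≡.sym dist≡i₀) ⟩
    h (dist x y) * A (dist x y) x y         ≈⟨ *-congˡ (𝟙-true (Dist-dist x y)) ⟩
    h (dist x y) * 1#                       ≈⟨ *-identityʳ _ ⟩
    h (dist x y)                            ∎
    where
    i₀ : Fin (suc D)
    i₀ = fromℕ< (s≤s (dist≤D x y))
    dist≡i₀ : dist x y ≡ toℕ i₀
    dist≡i₀ = ≡.sym (toℕ-fromℕ< (s≤s (dist≤D x y)))
    off : ∀ i → i ≢ i₀ → h (toℕ i) * A (toℕ i) x y ≈ 0#
    off i i≢i₀ = trans (*-congˡ (A-off (Dist-dist x y) (λ i≡j → i≢i₀ (toℕ-injective (≡.trans i≡j dist≡i₀)))))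
                       (zeroʳ _)

  pK : ℕ → ℕ → Carrier
  pK j k = natK F (p j 1 k)

  adjacency-action : ∀ (h : ℕ → Carrier) {Y j x y} → _≈ₘ_ F Y (radial h) → Dist j x y →
                     _*ₘ_ F (adjMat F G D) Y x y ≈ sumTo (suc D) (λ k → h k * pK j k)
  adjacency-action h {Y} {j} {x} {y} Y≈h d = begin
    sumFin F (λ z → A 1 x z * Y z y)
      ≡⟨ sumFin≡sum (λ z → A 1 x z * Y z y) ⟩
    ∑[ z < n ] (A 1 x z * Y z y)
      ≈⟨ sum-cong-≋ (λ z → *-congˡ (trans (Y≈h z y) (sym (A-expansion h z y)))) ⟩
    ∑[ z < n ] (A 1 x z * sumTo (suc D) (λ k → h k * A k z y))
      ≈⟨ sum-cong-≋ (λ z → trans (*-distribˡ-sumTo (suc D) (A 1 x z) (λ k → h k * A k z y))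
                                 (sumTo-cong (suc D) _ (λ k → h k * 𝟙 (meet z k))
                                             (λ k _ → regroup z k))) ⟩
    ∑[ z < n ] sumTo (suc D) (λ k → h k * 𝟙 (meet z k))
      ≈⟨ ∑-comm {n} {suc D} (λ z i → h (toℕ i) * 𝟙 (meet z (toℕ i))) ⟩
    sumTo (suc D) (λ k → ∑[ z < n ] (h k * 𝟙 (meet z k)))
      ≈⟨ sumTo-cong (suc D) _ (λ k → h k * pK j k) (λ k _ → count k) ⟩
    sumTo (suc D) (λ k → h k * pK j k) ∎
    where
    meet : Fin n → ℕ → Bool
    meet z k = distIs G 1 x z ∧ distIs G k y z
    regroup : ∀ z k → A 1 x z * (h k * A k z y) ≈ h k * 𝟙 (meet z k)
    regroup z k = trans (x∙yz≈y∙xz _ _ _) (*-congˡ (trans (sym (𝟙-∧ _ _))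
                    (reflexive (≡.cong (λ b → 𝟙 (distIs G 1 x z ∧ b)) (distIs-sym k z y)))))
    count : ∀ k → ∑[ z < n ] (h k * 𝟙 (meet z k)) ≈ h k * pK j k
    count k = trans (sym (*-distribˡ-sum (h k) (λ z → 𝟙 (meet z k))))
                    (*-congˡ (trans (sum-𝟙 (λ z → meet z k))
                                    (reflexive (≡.cong (natK F) (p-count 1 k d)))))

  Aθ : Mat F
  Aθ = _-ₘ_ F (adjMat F G D) (_·ₘ_ F θ (idM F))

  shifted-action : ∀ (h : ℕ → Carrier) {Y j x y} → _≈ₘ_ F Y (radial h) → Dist j x y →
                   _*ₘ_ F Aθ Y x y ≈ sumTo (suc D) (λ k → h k * pK j k) - θ * h j
  shifted-action h {Y} {j} {x} {y} Y≈h d = begin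
    _*ₘ_ F Aθ Y x y
      ≈⟨ [X-θZ]Y≈XY-θ[ZY] θ (adjMat F G D) (idM F) Y x y ⟩
    _*ₘ_ F (adjMat F G D) Y x y - θ * _*ₘ_ F (idM F) Y x y
      ≈⟨ +-cong (adjacency-action h Y≈h d)
                (-‿cong (*-congˡ (trans (*ₘ-identityˡ Y x y) (Y≈h x y)))) ⟩
    sumTo (suc D) (λ k → h k * pK j k) - θ * h (dist x y)
      ≡⟨ ≡.cong (λ i → sumTo (suc D) (λ k → h k * pK j k) - θ * h i) (≡.sym (Dist⇒≡dist d)) ⟩
    sumTo (suc D) (λ k → h k * pK j k) - θ * h j ∎

  b⁻¹ : ℕ → Carrier
  b⁻¹ j = natK⁻¹ (p j 1 (suc j))

  b-invertible : ∀ j → j < D → pK j (suc j) * b⁻¹ j ≈ 1#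
  b-invertible j j<D with realised (suc j) j<D
  ... | _ , _ , d = natK⁻¹-inverse (b≢0 d)

  open LinearRecurrence.Hessenberg commRing pK θ D b⁻¹ b-invertible

  truncate : ∀ (h : ℕ → Carrier) {j x y} → Dist j x y → j < D →
             sumTo (suc D) (λ k → h k * pK j k) ≈ sumTo (suc (suc j)) (λ k → h k * pK j k)
  truncate h {j} d j<D = sumTo-vanish (λ k → h k * pK j k) (s≤s j<D) (λ k 2+j≤k _ →
    trans (*-congˡ (reflexive (≡.cong (natK F) (p₁-vanish k d 2+j≤k)))) (zeroʳ (h k)))

  β : (ℕ → Carrier) → Carrier
  β h = sumTo (suc D) (λ k → h k * pK D k) - θ * h D

  solves⇒Aθ*Y≈β·A : ∀ (h : ℕ → Carrier) {Y} → _≈ₘ_ F Y (radial h) →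
                    (∀ j → j < D → Solves h j) →
                 _≈ₘ_ F (_*ₘ_ F Aθ Y) (_·ₘ_ F (β h) (A D))
  solves⇒Aθ*Y≈β·A h {Y} Y≈h solves x y with m≤n⇒m<n∨m≡n (dist≤D x y)
  ... | inj₁ j<D = begin
    _*ₘ_ F Aθ Y x y                          ≈⟨ shifted-action h Y≈h (Dist-dist x y) ⟩
    sumTo (suc D) (λ k → h k * pK j k) - θ * h j
      ≈⟨ +-congʳ (trans (truncate h (Dist-dist x y) j<D) (solves j j<D)) ⟩
    θ * h j - θ * h j                        ≈⟨ -‿inverseʳ (θ * h j) ⟩
    0#                                       ≈⟨ zeroʳ (β h) ⟨
    β h * 0#                                 ≈⟨ *-congˡ (A-off (Dist-dist x y) (>⇒≢ j<D)) ⟨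
    β h * A D x y                            ∎
    where
    j : ℕ
    j = dist x y
  ... | inj₂ j≡D = begin
    _*ₘ_ F Aθ Y x y                          ≈⟨ shifted-action h Y≈h dD ⟩
    β h                                      ≈⟨ *-identityʳ (β h) ⟨
    β h * 1#                                 ≈⟨ *-congˡ (𝟙-true dD) ⟨
    β h * A D x y                            ∎
    where
    dD : Dist D x y
    dD = ≡.subst (λ i → Dist i x y) j≡D (Dist-dist x y)

  Aθ*Y≈b·A⇒solves : ∀ (h : ℕ → Carrier) {Y b} → _≈ₘ_ F Y (radial h) →
                    _≈ₘ_ F (_*ₘ_ F Aθ Y) (_·ₘ_ F b (A D)) →
                 ∀ j → j < D → Solves h j
  Aθ*Y≈b·A⇒solves h {Y} {b} Y≈h eigen j j<D with realised j (<⇒≤ j<D)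
  ... | u , v , d = x∙y⁻¹≈ε⇒x≈y _ _ (begin
    sumTo (suc (suc j)) (λ k → h k * pK j k) - θ * h j ≈⟨ +-congʳ (truncate h d j<D) ⟨
    sumTo (suc D) (λ k → h k * pK j k) - θ * h j       ≈⟨ shifted-action h Y≈h d ⟨
    _*ₘ_ F Aθ Y u v                                    ≈⟨ eigen u v ⟩
    b * A D u v                                        ≈⟨ *-congˡ (A-off d (>⇒≢ j<D)) ⟩
    b * 0#                                             ≈⟨ zeroʳ b ⟩
    0#                                                 ∎)

  radial-InBM : ∀ h → InBM F G D (radial h)
  radial-InBM h = (λ i → h (toℕ i)) , λ x y →
    trans (sym (A-expansion h x y))
          (reflexive (≡.sym (sumFin≡sum {suc D} (λ i → h (toℕ i) * A (toℕ i) x y))))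

  InBM⇒radial : ∀ {Y} → InBM F G D Y → ∃ λ h → _≈ₘ_ F Y (radial h)
  InBM⇒radial {Y} (γ , Y≈∑γA) = h , λ x y → begin
    Y x y                                   ≈⟨ Y≈∑γA x y ⟩
    sumFin F (λ i → γ i * A (toℕ i) x y)    ≡⟨ sumFin≡sum {suc D} (λ i → γ i * A (toℕ i) x y) ⟩
    ∑[ i < suc D ] (γ i * A (toℕ i) x y)     ≈⟨ sum-cong-≋ (λ i → *-congʳ {A (toℕ i) x y} (reflexive (γ≡h i))) ⟩
    sumTo (suc D) (λ k → h k * A k x y)     ≈⟨ A-expansion h x y ⟩
    radial h x y                            ∎
    where
    h : ℕ → Carrier
    h = extendToℕ γ 0#
    γ≡h : ∀ i → γ i ≡ h (toℕ i)
    γ≡h i = ≡.sym (extendToℕ-toℕ γ 0# i)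

  radial-nonzero : ∀ h → ¬ h 0 ≈ 0# → ¬ _≈ₘ_ F (radial h) (zeroM F)
  radial-nonzero h h0≉0 h≈0 =
    h0≉0 (trans (reflexive (≡.cong h (Dist⇒≡dist (within-refl x)))) (h≈0 x x))
    where
    x : Fin n
    x = proj₁ (proj₂ hD)

  Mθ-dimOne : DimOne F (InMθ F G D (just θ))
  Mθ-dimOne = radial solution , (radial-InBM solution , β solution , shifted)
            , radial-nonzero solution 1≉0 , spans
    where
    shifted : _≈ₘ_ F (_*ₘ_ F Aθ (radial solution)) (_·ₘ_ F (β solution) (A D))
    shifted = solves⇒Aθ*Y≈β·A solution (λ _ _ → ≈-refl) solution-solves
    spans : ∀ Y → InMθ F G D (just θ) Y → ∃ λ a → _≈ₘ_ F Y (_·ₘ_ F a (radial solution))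
    spans Y (inBM , b , eigen) with InBM⇒radial inBM
    ... | h , Y≈h = h 0 , λ x y →
      trans (Y≈h x y) (solution-unique h (Aθ*Y≈b·A⇒solves h Y≈h eigen) (dist x y) (dist≤D x y))

M∞-dimOne : ∀ {c ℓ} (F : Field c ℓ) {n} (G : Graph n) D → HasDiameter G D →
            DimOne F (InMθ F G D nothing)
M∞-dimOne F {n} G D (_ , x , y , dD) =
  distMat F G D D , (1# , λ _ _ → sym (*-identityˡ _)) , nonzero , λ _ spans → spans
  where
  open Field F
  open Matrices F {n}
  nonzero : ¬ _≈ₘ_ F (distMat F G D D) (zeroM F)
  nonzero AD≈0 = 1≉0 (trans (sym (𝟙-true dD)) (AD≈0 x y))

corollary6p4 : ∀ {c ℓ} (F : Field c ℓ) → CharZero F → AlgClosed F →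
    (n : ℕ) (G : Graph n) (D : ℕ) → 3 ≤ D →
    HasDiameter G D → DistanceRegular G →
    (θ : Maybe (Field.Carrier F)) → DimOne F (InMθ F G D θ)
corollary6p4 F char _ n G D _ hD dr (just θ) = BoseMesner.Mθ-dimOne F char G D hD dr θ
corollary6p4 F _    _ n G D _ hD _  nothing  = M∞-dimOne F G D hD
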